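{- For every integer $n \geq 3$, $$\kappa(K_n \times K_n) = \begin{cases} 6, & n=3;\\ 2n+2, & n\ge 4.\end{cases}$$
   Context: For graphs $G,H$, the direct product $G\times H$ has vertex set $V(G)\times V(H)$, with $(g,h)$ adjacent to $(g',h')$ iff $gg'\in E(G)$ and $hh'\in E(H)$. Thus $K_n\times K_n$ has vertex set $[n]\times[n]$ (where $[n]=\{1,\dots,n\}$), and $(i,j)$ is adjacent to $(i',j')$ iff $i\ne i'$ and $j\ne j'$. For a connected graph $G$, $d_G$ denotes the shortest-path distance. For $S\subseteq V(G)$ and $x,y,z\in V(G)$, let $\Delta_z(x,y)=|d_G(x,z)-d_G(y,z)|$ and $\Delta_S(x,y)=\sum_{z\in S}\Delta_z(x,y)$. For an integer $k\ge 1$, $S$ is a weak $k$-resolving set of $G$ if $\Delta_S(x,y)\ge k$ for every two distinct vertices $x,y$. $\kappa(G)$ denotes the largest integer $k$ such that $G$ has a weak $k$-resolving set. -}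

module Defs where

open import Data.Nat using (ℕ; zero; suc; _+_; _≤_; ∣_-_∣)
open import Data.Fin using (Fin; zero; suc)
open import Data.Bool using (Bool; if_then_else_)
open import Data.Product using (_×_; _,_; Σ; ∃)
open import Relation.Binary.PropositionalEquality using (_≡_)
open import Relation.Nullary using (¬_)

data Walk {V : Set} (Adj : V → V → Set) : V → V → ℕ → Set where
  here : ∀ {x} → Walk Adj x x 0
  step : ∀ {x y z l} → Adj x y → Walk Adj y z l → Walk Adj x z (suc l)

IsShortestPathDist : {V : Set} → (V → V → Set) → (V → V → ℕ) → Set
IsShortestPathDist {V} Adj d =
  ∀ (x y : V) → Walk Adj x y (d x y) × (∀ l → Walk Adj x y l → d x y ≤ l)

KnKn-Adj : (n : ℕ) → Fin n × Fin n → Fin n × Fin n → Set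
KnKn-Adj n (i , j) (i' , j') = ¬ (i ≡ i') × ¬ (j ≡ j')

sumFin : (n : ℕ) → (Fin n → ℕ) → ℕ
sumFin zero    f = 0
sumFin (suc n) f = f zero + sumFin n (λ i → f (suc i))

sumFin² : (n : ℕ) → (Fin n × Fin n → ℕ) → ℕ
sumFin² n f = sumFin n (λ i → sumFin n (λ j → f (i , j)))

VSubset : ℕ → Set
VSubset n = Fin n × Fin n → Bool

ΔS : (n : ℕ) → (d : Fin n × Fin n → Fin n × Fin n → ℕ) →
     VSubset n → Fin n × Fin n → Fin n × Fin n → ℕ
ΔS n d S x y = sumFin² n (λ z → if S z then ∣ d x z - d y z ∣ else 0)

IsWeakResolving : (n : ℕ) → (d : Fin n × Fin n → Fin n × Fin n → ℕ) →
                  ℕ → VSubset n → Set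
IsWeakResolving n d k S =
  1 ≤ k × (∀ x y → ¬ (x ≡ y) → k ≤ ΔS n d S x y)

IsKappa : (n : ℕ) → (d : Fin n × Fin n → Fin n × Fin n → ℕ) → ℕ → Set
IsKappa n d k =
  Σ (VSubset n) (IsWeakResolving n d k) ×
  (∀ k' → Σ (VSubset n) (IsWeakResolving n d k') → k' ≤ k)

kappaValue : ℕ → ℕ
kappaValue 3 = 6
kappaValue n = 2 * n + 2
  where open import Data.Nat using (_*_)

-- Two vertices of K_n × K_n are at distance 0, 1 or 2 according as they agree in
-- both, neither, or exactly one coordinate.  Since Δ_S(x,y) only grows with S, the
-- whole vertex set V is an optimal weak resolving set, so κ is the minimum of
-- Δ_V(x,y) over distinct x, y.  Summing row by row, Δ_V(x,y) = 2n + 2 when x and y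
-- share a row or a column and 4n − 6 otherwise; the minimum is 6 for n = 3 and
-- 2n + 2 for n ≥ 4.
module Submission where

open import Defs
open import Data.Nat using (ℕ; _≤_)
open import Data.Fin using (Fin)
open import Data.Product using (_×_; Σ)

open import Data.Bool using (Bool; true; false; if_then_else_)
open import Data.Empty using (⊥-elim)
open import Data.Fin using (zero; suc; punchIn; punchOut)
open import Data.Fin.Properties using (_≟_; punchInᵢ≢i; punchIn-punchOut; punchIn-injective)
open import Data.List using (_∷_; [])
open import Data.Nat using (zero; suc; _+_; _*_; ∣_-_∣; z≤n; s≤s)
open import Data.Nat.Properties
  using (+-commutativeSemigroup; +-assoc; ∣-∣-comm; m≤m+n; ≤-refl; ≤-reflexive; ≤-trans; ≤-antisym;
         +-mono-≤; +-monoʳ-≤; *-monoˡ-≤; module ≤-Reasoning)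
open import Algebra.Properties.CommutativeSemigroup +-commutativeSemigroup using (x∙yz≈y∙xz)
open import Data.Nat.Tactic.RingSolver using (solve)
open import Data.Product using (_,_; proj₁; proj₂; ∃)
open import Relation.Binary.PropositionalEquality
  using (_≡_; _≢_; refl; sym; trans; cong; cong₂; ≢-sym; module ≡-Reasoning)
open import Relation.Nullary using (does; yes; no)
open import Relation.Nullary.Decidable using (dec-true; dec-false)

shortestPathDist-unique : ∀ {V : Set} {Adj : V → V → Set} {d d′ : V → V → ℕ} →
  IsShortestPathDist Adj d → IsShortestPathDist Adj d′ → ∀ x y → d x y ≡ d′ x y
shortestPathDist-unique d-spd d′-spd x y =
  ≤-antisym (proj₂ (d-spd x y) _ (proj₁ (d′-spd x y)))
            (proj₂ (d′-spd x y) _ (proj₁ (d-spd x y)))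

sumFin-cong : ∀ n {f g : Fin n → ℕ} → (∀ i → f i ≡ g i) → sumFin n f ≡ sumFin n g
sumFin-cong zero    f≗g = refl
sumFin-cong (suc n) f≗g = cong₂ _+_ (f≗g zero) (sumFin-cong n (λ i → f≗g (suc i)))

sumFin-mono-≤ : ∀ n {f g : Fin n → ℕ} → (∀ i → f i ≤ g i) → sumFin n f ≤ sumFin n g
sumFin-mono-≤ zero    f≤g = z≤n
sumFin-mono-≤ (suc n) f≤g = +-mono-≤ (f≤g zero) (sumFin-mono-≤ n (λ i → f≤g (suc i)))

sumFin-const : ∀ n c → sumFin n (λ _ → c) ≡ n * c
sumFin-const zero    c = refl
sumFin-const (suc n) c = cong (c +_) (sumFin-const n c)

sumFin-punchIn : ∀ k (a : Fin (suc k)) (g : Fin (suc k) → ℕ) →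
  sumFin (suc k) g ≡ g a + sumFin k (λ j → g (punchIn a j))
sumFin-punchIn k       zero    g = refl
sumFin-punchIn (suc k) (suc a) g =
  trans (cong (g zero +_) (sumFin-punchIn k a (λ i → g (suc i)))) (x∙yz≈y∙xz (g zero) (g (suc a)) _)

sumFin-except : ∀ {k p c} (g : Fin (suc k) → ℕ) (a : Fin (suc k)) →
  g a ≡ p → (∀ i → a ≢ i → g i ≡ c) → sumFin (suc k) g ≡ p + k * c
sumFin-except {k} {p} {c} g a ga≡p others = begin
  sumFin (suc k) g                          ≡⟨ sumFin-punchIn k a g ⟩
  g a + sumFin k (λ j → g (punchIn a j))    ≡⟨ cong₂ _+_ ga≡p (sumFin-cong k (λ j → others _ (≢-sym (punchInᵢ≢i a j)))) ⟩
  p + sumFin k (λ _ → c)                    ≡⟨ cong (p +_) (sumFin-const k c) ⟩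
  p + k * c                                 ∎
  where open ≡-Reasoning

sumFin-except₂ : ∀ {k p q c} (g : Fin (suc (suc k)) → ℕ) {a b} → a ≢ b → g a ≡ p → g b ≡ q →
  (∀ i → a ≢ i → b ≢ i → g i ≡ c) → sumFin (suc (suc k)) g ≡ p + q + k * c
sumFin-except₂ {k} {p} {q} {c} g {a} {b} a≢b ga≡p gb≡q others = begin
  sumFin (suc (suc k)) g                        ≡⟨ sumFin-punchIn (suc k) a g ⟩
  g a + sumFin (suc k) (λ j → g (punchIn a j))
    ≡⟨ cong₂ _+_ ga≡p (sumFin-except (λ j → g (punchIn a j)) (punchOut a≢b) gb′≡q others′) ⟩
  p + (q + k * c)                               ≡⟨ sym (+-assoc p q (k * c)) ⟩
  p + q + k * c                                 ∎
  where
  open ≡-Reasoning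
  gb′≡q : g (punchIn a (punchOut a≢b)) ≡ q
  gb′≡q = trans (cong g (punchIn-punchOut a≢b)) gb≡q
  others′ : ∀ j → punchOut a≢b ≢ j → g (punchIn a j) ≡ c
  others′ j b′≢j = others _ (≢-sym (punchInᵢ≢i a j)) λ b≡aj →
    b′≢j (punchIn-injective a _ j (trans (punchIn-punchOut a≢b) b≡aj))

sumFin²-cong : ∀ n {f g : Fin n × Fin n → ℕ} → (∀ z → f z ≡ g z) → sumFin² n f ≡ sumFin² n g
sumFin²-cong n f≗g = sumFin-cong n (λ i → sumFin-cong n (λ j → f≗g (i , j)))

sumFin²-mono-≤ : ∀ n {f g : Fin n × Fin n → ℕ} → (∀ z → f z ≤ g z) → sumFin² n f ≤ sumFin² n g
sumFin²-mono-≤ n f≤g = sumFin-mono-≤ n (λ i → sumFin-mono-≤ n (λ j → f≤g (i , j)))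

allVertices : ∀ {n} → VSubset n
allVertices _ = true

ΔV : (n : ℕ) → (Fin n × Fin n → Fin n × Fin n → ℕ) → Fin n × Fin n → Fin n × Fin n → ℕ
ΔV n d = ΔS n d allVertices

ΔS-≤-ΔV : ∀ n d S x y → ΔS n d S x y ≤ ΔV n d x y
ΔS-≤-ΔV n d S x y = sumFin²-mono-≤ n (λ z → if-≤ (S z))
  where
  if-≤ : ∀ b {m} → (if b then m else 0) ≤ m
  if-≤ true  = ≤-refl
  if-≤ false = z≤n

ΔS-cong : ∀ n {d d′} S → (∀ x y → d x y ≡ d′ x y) → ∀ x y → ΔS n d S x y ≡ ΔS n d′ S x y
ΔS-cong n S d≗d′ x y = sumFin²-cong n λ z →
  cong (λ t → if S z then t else 0) (cong₂ ∣_-_∣ (d≗d′ x z) (d≗d′ y z))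

isKappa-allVertices : ∀ {n d v} → 1 ≤ v → (∀ x y → x ≢ y → v ≤ ΔV n d x y) →
  ∀ {x₀ y₀} → x₀ ≢ y₀ → ΔV n d x₀ y₀ ≤ v → IsKappa n d v
isKappa-allVertices {n} {d} v≥1 lower {x₀} {y₀} x₀≢y₀ upper =
  (allVertices , v≥1 , lower) ,
  λ { _ (S , _ , S-resolves) → ≤-trans (S-resolves x₀ y₀ x₀≢y₀) (≤-trans (ΔS-≤-ΔV n d S x₀ y₀) upper) }

avoid₂ : ∀ {n} → 3 ≤ n → (p q : Fin n) → ∃ λ r → r ≢ p × r ≢ q
avoid₂ (s≤s (s≤s (s≤s _))) p q with zero ≟ p | zero ≟ q
... | no 0≢p   | no 0≢q   = zero , 0≢p , 0≢q
... | yes refl | _        with suc zero ≟ q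
...   | no 1≢q   = suc zero , (λ ()) , 1≢q
...   | yes refl = suc (suc zero) , (λ ()) , (λ ())
avoid₂ (s≤s (s≤s (s≤s _))) p q | no 0≢p | yes refl with suc zero ≟ p
...   | no 1≢p   = suc zero , 1≢p , (λ ())
...   | yes refl = suc (suc zero) , (λ ()) , (λ ())

-- The arguments record whether the first, resp. second, coordinates agree.
distCode : Bool → Bool → ℕ
distCode true  true  = 0
distCode true  false = 2
distCode false true  = 2
distCode false false = 1

module _ {n : ℕ} where

  dist : Fin n × Fin n → Fin n × Fin n → ℕ
  dist (a , b) (c , e) = distCode (does (a ≟ c)) (does (b ≟ e))

  dist-self : ∀ x → dist x x ≡ 0
  dist-self (a , b) = cong₂ distCode (dec-true (a ≟ a) refl) (dec-true (b ≟ b) refl)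

  dist-sameRow : ∀ a {b e} → b ≢ e → dist (a , b) (a , e) ≡ 2
  dist-sameRow a {b} {e} b≢e = cong₂ distCode (dec-true (a ≟ a) refl) (dec-false (b ≟ e) b≢e)

  dist-sameColumn : ∀ {a c} b → a ≢ c → dist (a , b) (c , b) ≡ 2
  dist-sameColumn {a} {c} b a≢c = cong₂ distCode (dec-false (a ≟ c) a≢c) (dec-true (b ≟ b) refl)

  dist-adjacent : ∀ {a b c e} → a ≢ c → b ≢ e → dist (a , b) (c , e) ≡ 1
  dist-adjacent {a} {b} {c} {e} a≢c b≢e = cong₂ distCode (dec-false (a ≟ c) a≢c) (dec-false (b ≟ e) b≢e)

  dist-≤-2 : ∀ x y → dist x y ≤ 2
  dist-≤-2 (a , b) (c , e) with does (a ≟ c) | does (b ≟ e)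
  ... | true  | true  = z≤n
  ... | true  | false = ≤-refl
  ... | false | true  = ≤-refl
  ... | false | false = s≤s z≤n

  dist-≤-length : ∀ {x y l} → Walk (KnKn-Adj n) x y l → dist x y ≤ l
  dist-≤-length {x} here                  = ≤-reflexive (dist-self x)
  dist-≤-length (step (a≢c , b≢e) here)   = ≤-reflexive (dist-adjacent a≢c b≢e)
  dist-≤-length {x} {y} (step _ (step _ _)) = ≤-trans (dist-≤-2 x y) (s≤s (s≤s z≤n))

  module _ (3≤n : 3 ≤ n) where

    commonNeighbour-walk : ∀ x y → Walk (KnKn-Adj n) x y 2
    commonNeighbour-walk (a , b) (c , e) with avoid₂ 3≤n a c | avoid₂ 3≤n b e
    ... | r , r≢a , r≢c | s , s≢b , s≢e = step (≢-sym r≢a , ≢-sym s≢b) (step (r≢c , s≢e) here)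

    dist-walk : ∀ x y → Walk (KnKn-Adj n) x y (dist x y)
    dist-walk (a , b) (c , e) with a ≟ c | b ≟ e
    ... | yes refl | yes refl = here
    ... | yes _    | no _     = commonNeighbour-walk (a , b) (c , e)
    ... | no _     | yes _    = commonNeighbour-walk (a , b) (c , e)
    ... | no a≢c   | no b≢e   = step (a≢c , b≢e) here

    dist-isShortestPathDist : IsShortestPathDist (KnKn-Adj n) dist
    dist-isShortestPathDist x y = dist-walk x y , λ _ → dist-≤-length

  gap : Fin n × Fin n → Fin n × Fin n → Fin n × Fin n → ℕ
  gap x y z = ∣ dist x z - dist y z ∣

  rowGap : Fin n × Fin n → Fin n × Fin n → Fin n → ℕ
  rowGap x y i = sumFin n (λ j → gap x y (i , j))

  rowGap-comm : ∀ x y i → rowGap x y i ≡ rowGap y x i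
  rowGap-comm x y i = sumFin-cong n (λ j → ∣-∣-comm (dist x (i , j)) (dist y (i , j)))

rowGap-other : ∀ {k} {a b c e i : Fin (suc (suc k))} → a ≢ i → c ≢ i → b ≢ e →
  rowGap (a , b) (c , e) i ≡ 2
rowGap-other {k} {a} {b} {c} {e} {i} a≢i c≢i b≢e = trans
  (sumFin-except₂ (λ j → gap (a , b) (c , e) (i , j)) b≢e
    (cong₂ ∣_-_∣ (dist-sameColumn b a≢i) (dist-adjacent c≢i (≢-sym b≢e)))
    (cong₂ ∣_-_∣ (dist-adjacent a≢i b≢e) (dist-sameColumn e c≢i))
    (λ j b≢j e≢j → cong₂ ∣_-_∣ (dist-adjacent a≢i b≢j) (dist-adjacent c≢i e≢j)))
  (solve (k ∷ []))

rowGap-other-sameColumn : ∀ {k} {a b c i : Fin (suc k)} → a ≢ i → c ≢ i →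
  rowGap (a , b) (c , b) i ≡ 0
rowGap-other-sameColumn {k} {a} {b} {c} {i} a≢i c≢i = trans
  (sumFin-except (λ j → gap (a , b) (c , b) (i , j)) b
    (cong₂ ∣_-_∣ (dist-sameColumn b a≢i) (dist-sameColumn b c≢i))
    (λ j b≢j → cong₂ ∣_-_∣ (dist-adjacent a≢i b≢j) (dist-adjacent c≢i b≢j)))
  (solve (k ∷ []))

rowGap-own-sameRow : ∀ {k} a {b e : Fin (suc (suc k))} → b ≢ e →
  rowGap (a , b) (a , e) a ≡ 4
rowGap-own-sameRow {k} a {b} {e} b≢e = trans
  (sumFin-except₂ (λ j → gap (a , b) (a , e) (a , j)) b≢e
    (cong₂ ∣_-_∣ (dist-self (a , b)) (dist-sameRow a (≢-sym b≢e)))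
    (cong₂ ∣_-_∣ (dist-sameRow a b≢e) (dist-self (a , e)))
    (λ j b≢j e≢j → cong₂ ∣_-_∣ (dist-sameRow a b≢j) (dist-sameRow a e≢j)))
  (solve (k ∷ []))

rowGap-own-sameColumn : ∀ {k} {a c : Fin (suc k)} b → a ≢ c →
  rowGap (a , b) (c , b) a ≡ 2 + k
rowGap-own-sameColumn {k} {a} {c} b a≢c = trans
  (sumFin-except (λ j → gap (a , b) (c , b) (a , j)) b
    (cong₂ ∣_-_∣ (dist-self (a , b)) (dist-sameColumn b (≢-sym a≢c)))
    (λ j b≢j → cong₂ ∣_-_∣ (dist-sameRow a b≢j) (dist-adjacent (≢-sym a≢c) b≢j)))
  (solve (k ∷ []))

rowGap-own-diagonal : ∀ {k} {a b c e : Fin (suc (suc k))} → a ≢ c → b ≢ e →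
  rowGap (a , b) (c , e) a ≡ suc k
rowGap-own-diagonal {k} {a} {b} {c} {e} a≢c b≢e = trans
  (sumFin-except₂ (λ j → gap (a , b) (c , e) (a , j)) b≢e
    (cong₂ ∣_-_∣ (dist-self (a , b)) (dist-adjacent (≢-sym a≢c) (≢-sym b≢e)))
    (cong₂ ∣_-_∣ (dist-sameRow a b≢e) (dist-sameColumn e (≢-sym a≢c)))
    (λ j b≢j e≢j → cong₂ ∣_-_∣ (dist-sameRow a b≢j) (dist-adjacent (≢-sym a≢c) e≢j)))
  (solve (k ∷ []))

module _ {k : ℕ} where

  ΔV-sameRow : ∀ (a : Fin (2 + k)) {b e} → b ≢ e →
    ΔV (2 + k) dist (a , b) (a , e) ≡ 2 * (2 + k) + 2
  ΔV-sameRow a {b} {e} b≢e = trans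
    (sumFin-except (rowGap (a , b) (a , e)) a
      (rowGap-own-sameRow a b≢e)
      (λ i a≢i → rowGap-other a≢i a≢i b≢e))
    (solve (k ∷ []))

  ΔV-sameColumn : ∀ {a c : Fin (2 + k)} b → a ≢ c →
    ΔV (2 + k) dist (a , b) (c , b) ≡ 2 * (2 + k) + 2
  ΔV-sameColumn {a} {c} b a≢c = trans
    (sumFin-except₂ (rowGap (a , b) (c , b)) a≢c
      (rowGap-own-sameColumn b a≢c)
      (trans (rowGap-comm (a , b) (c , b) c) (rowGap-own-sameColumn b (≢-sym a≢c)))
      (λ i a≢i c≢i → rowGap-other-sameColumn {b = b} a≢i c≢i))
    (solve (k ∷ []))

  ΔV-diagonal : ∀ {a b c e : Fin (2 + k)} → a ≢ c → b ≢ e →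
    ΔV (2 + k) dist (a , b) (c , e) ≡ 4 * k + 2
  ΔV-diagonal {a} {b} {c} {e} a≢c b≢e = trans
    (sumFin-except₂ (rowGap (a , b) (c , e)) a≢c
      (rowGap-own-diagonal a≢c b≢e)
      (trans (rowGap-comm (a , b) (c , e) c) (rowGap-own-diagonal (≢-sym a≢c) (≢-sym b≢e)))
      (λ i a≢i c≢i → rowGap-other a≢i c≢i b≢e))
    (solve (k ∷ []))

  ΔV-lower : ∀ {v} → v ≤ 2 * (2 + k) + 2 → v ≤ 4 * k + 2 →
    ∀ x y → x ≢ y → v ≤ ΔV (2 + k) dist x y
  ΔV-lower v≤line v≤diagonal (a , b) (c , e) x≢y with a ≟ c | b ≟ e
  ... | yes refl | yes refl = ⊥-elim (x≢y refl)
  ... | yes refl | no b≢e   = ≤-trans v≤line (≤-reflexive (sym (ΔV-sameRow a b≢e)))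
  ... | no a≢c   | yes refl = ≤-trans v≤line (≤-reflexive (sym (ΔV-sameColumn b a≢c)))
  ... | no a≢c   | no b≢e   = ≤-trans v≤diagonal (≤-reflexive (sym (ΔV-diagonal a≢c b≢e)))

  isKappa-KnKn : 3 ≤ 2 + k → ∀ {v} → 1 ≤ v → v ≤ 2 * (2 + k) + 2 → v ≤ 4 * k + 2 →
    ∀ {x₀ y₀} → x₀ ≢ y₀ → ΔV (2 + k) dist x₀ y₀ ≡ v →
    ∀ d → IsShortestPathDist (KnKn-Adj (2 + k)) d → IsKappa (2 + k) d v
  isKappa-KnKn 3≤n v≥1 v≤line v≤diagonal {x₀} {y₀} x₀≢y₀ ΔV₀≡v d d-spd =
    isKappa-allVertices {d = d} v≥1
      (λ x y x≢y → ≤-trans (ΔV-lower v≤line v≤diagonal x y x≢y)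
                            (≤-reflexive (sym (ΔV-d≡ΔV-dist x y))))
      x₀≢y₀ (≤-reflexive (trans (ΔV-d≡ΔV-dist x₀ y₀) ΔV₀≡v))
    where
    ΔV-d≡ΔV-dist : ∀ x y → ΔV (2 + k) d x y ≡ ΔV (2 + k) dist x y
    ΔV-d≡ΔV-dist =
      ΔS-cong (2 + k) allVertices (shortestPathDist-unique d-spd (dist-isShortestPathDist 3≤n))

mainTheorem1 : (n : ℕ) → 3 ≤ n →
    Σ (Fin n × Fin n → Fin n × Fin n → ℕ) (IsShortestPathDist (KnKn-Adj n)) ×
    (∀ (d : Fin n × Fin n → Fin n × Fin n → ℕ) →
    IsShortestPathDist (KnKn-Adj n) d → IsKappa n d (kappaValue n))
mainTheorem1 n 3≤n = (dist , dist-isShortestPathDist 3≤n) , kappa n 3≤n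
  where
  kappa : ∀ n → 3 ≤ n → ∀ d → IsShortestPathDist (KnKn-Adj n) d → IsKappa n d (kappaValue n)
  kappa 1 (s≤s ())
  kappa 2 (s≤s (s≤s ()))
  kappa 3 3≤n = isKappa-KnKn {1} 3≤n (s≤s z≤n) (m≤m+n 6 2) ≤-refl
    {zero , zero} {suc zero , suc zero} (λ ())
    (ΔV-diagonal {1} {zero} {zero} {suc zero} {suc zero} (λ ()) (λ ()))
  kappa (suc (suc (suc (suc m)))) 3≤n = isKappa-KnKn {2 + m} 3≤n (s≤s z≤n) ≤-refl line≤diagonal
    {zero , zero} {zero , suc zero} (λ ()) (ΔV-sameRow {2 + m} zero {zero} {suc zero} (λ ()))
    where
    open ≤-Reasoning
    line≤diagonal : 2 * (4 + m) + 2 ≤ 4 * (2 + m) + 2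
    line≤diagonal = begin
      2 * (4 + m) + 2  ≡⟨ solve (m ∷ []) ⟩
      10 + 2 * m       ≤⟨ +-monoʳ-≤ 10 (*-monoˡ-≤ m (m≤m+n 2 2)) ⟩
      10 + 4 * m       ≡⟨ solve (m ∷ []) ⟩
      4 * (2 + m) + 2  ∎
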